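{- The following hold. (i) For every NTS $\Sigma$ and every positive integer $K$: if $\Sigma$ is infinite-step opaque then it is $K$-step opaque, current-state opaque and initial-state opaque; and if $\Sigma$ is $K$-step opaque then it is current-state opaque. (ii) There exists an NTS that is current-state opaque but not initial-state opaque; there exist a positive integer $K$ and an NTS that is current-state opaque but not $K$-step opaque; there exists an NTS that is current-state opaque but not infinite-step opaque. (iii) There exist a positive integer $K$ and an NTS that is $K$-step opaque but not infinite-step opaque; there exist a positive integer $K$ and an NTS that is $K$-step opaque but not initial-state opaque. (iv) There exists an NTS that is initial-state opaque but not current-state opaque; there exist a positive integer $K$ and an NTS that is initial-state opaque but not $K$-step opaque; there exists an NTS that is initial-state opaque but not infinite-step opaque.
   Context: A nondeterministic transition system (NTS) is a tuple $\Sigma=(X,X_0,S,U,\to,Y,h)$, where $X$ is a (possibly infinite) set of states, $X_0\subseteq X$ the initial states, $S\subseteq X$ the secret states, $U$ a (possibly infinite) set of inputs, $\to\subseteq X\times U\times X$ the transition relation, $Y$ a set of outputs and $h:X\to Y$ the output map. $U^*$ is the set of finite sequences $\alpha=\alpha(0)\cdots\alpha(|\alpha|-1)$ over $U$, including the empty one. For $\alpha\in U^*$, a run over $\alpha$ is a nonempty sequence of states $x_0x_1\dots x_k$ with $k\le|\alpha|$, $x_0\in X_0$ and $(x_j,\alpha(j),x_{j+1})\in\to$ for all $j\in\{0,\dots,k-1\}$; it is maximal if $k=|\alpha|$ or there is no $x'$ with $(x_k,\alpha(k),x')\in\to$. Initial-state opaque: for every $\alpha\in U^*$ and every maximal run $x_0\dots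 x_k$ over $\alpha$ with $x_0\in X_0\cap S$, there is a maximal run $x_0'\dots x_k'$ over $\alpha$ with $x_0'\notin S$ and $h(x_j)=h(x_j')$ for all $j\in\{0,\dots,k\}$. Current-state opaque: for every $\alpha\in U^*$ and every run $x_0\dots x_{|\alpha|}$ over $\alpha$ with $x_{|\alpha|}\in S$ there is a run $x_0'\dots x_{|\alpha|}'$ over $\alpha$ with $x'_{|\alpha|}\notin S$ and $h(x_j)=h(x_j')$ for all $j\in\{0,\dots,|\alpha|\}$. $K$-step opaque ($K$ a positive integer): for every $\alpha\in U^*$, every run $x_0\dots x_{|\alpha|}$ over $\alpha$ and every $i$ with $\max\{0,|\alpha|-K\}\le i\le|\alpha|$ and $x_i\in S$, there is a run $x_0'\dots x'_{|\alpha|}$ over $\alpha$ with $x_i'\notin S$ and $h(x_j)=h(x_j')$ for all $j\in\{0,\dots,|\alpha|\}$. Infinite-step opaque: for every $\alpha\in U^*$, every maximal run $x_0\dots x_k$ over $\alpha$ and every $i\in\{0,\dots,k\}$ with $x_i\in S$, there is a maximal run $x_0'\dots x_k'$ over $\alpha$ with $x_i'\notin S$ and $h(x_j)=h(x_j')$ for all $j\in\{0,\dots,k\}$. -}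

module Defs where

open import Data.Nat using (ℕ; _≤_; _<_; _∸_)
open import Data.Nat.Properties using (≤-refl)
open import Data.Fin using (Fin; zero; suc; inject₁; inject≤; fromℕ; fromℕ<; toℕ)
open import Data.Product using (Σ; _×_; ∃)
open import Data.Sum using (_⊎_)
open import Relation.Nullary using (¬_)
open import Relation.Binary.PropositionalEquality using (_≡_)

record NTS : Set₁ where
  field
    X     : Set
    X₀    : X → Set
    S     : X → Set
    U     : Set
    Trans : X → U → X → Set
    Y     : Set
    h     : X → Y

module _ (T : NTS) where
  open NTS T

  -- A run over α of length k (k ≤ n) is a sequence x₀ … x_k, i.e. x : Fin (suc k) → X,
  -- with x₀ ∈ X₀ and (x_j , α(j) , x_{j+1}) ∈ → for all j < k.
  IsRun : ∀ {n} (α : Fin n → U) {k} (k≤n : k ≤ n) (x : Fin (ℕ.suc k) → X) → Set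
  IsRun α {k} k≤n x =
    X₀ (x zero) × ((j : Fin k) → Trans (x (inject₁ j)) (α (inject≤ j k≤n)) (x (suc j)))

  IsMaximal : ∀ {n} (α : Fin n → U) {k} (k≤n : k ≤ n) (x : Fin (ℕ.suc k) → X) → Set
  IsMaximal {n} α {k} k≤n x =
    k ≡ n ⊎ Σ (k < n) (λ k<n → (x' : X) → ¬ Trans (x (fromℕ k)) (α (fromℕ< k<n)) x')

  SameOutputs : ∀ {k} (x x' : Fin (ℕ.suc k) → X) → Set
  SameOutputs x x' = (j : Fin _) → h (x j) ≡ h (x' j)

  InitialStateOpaque : Set
  InitialStateOpaque =
    ∀ n (α : Fin n → U) k (k≤n : k ≤ n) (x : Fin (ℕ.suc k) → X) →
    IsRun α k≤n x → IsMaximal α k≤n x → S (x zero) →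
    ∃ λ (x' : Fin (ℕ.suc k) → X) →
      IsRun α k≤n x' × IsMaximal α k≤n x' × ¬ S (x' zero) × SameOutputs x x'

  CurrentStateOpaque : Set
  CurrentStateOpaque =
    ∀ n (α : Fin n → U) (x : Fin (ℕ.suc n) → X) →
    IsRun α ≤-refl x → S (x (fromℕ n)) →
    ∃ λ (x' : Fin (ℕ.suc n) → X) →
      IsRun α ≤-refl x' × ¬ S (x' (fromℕ n)) × SameOutputs x x'

  KStepOpaque : ℕ → Set
  KStepOpaque K =
    ∀ n (α : Fin n → U) (x : Fin (ℕ.suc n) → X) →
    IsRun α ≤-refl x → (i : Fin (ℕ.suc n)) → n ∸ K ≤ toℕ i → S (x i) →
    ∃ λ (x' : Fin (ℕ.suc n) → X) →
      IsRun α ≤-refl x' × ¬ S (x' i) × SameOutputs x x'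

  InfiniteStepOpaque : Set
  InfiniteStepOpaque =
    ∀ n (α : Fin n → U) k (k≤n : k ≤ n) (x : Fin (ℕ.suc k) → X) →
    IsRun α k≤n x → IsMaximal α k≤n x → (i : Fin (ℕ.suc k)) → S (x i) →
    ∃ λ (x' : Fin (ℕ.suc k) → X) →
      IsRun α k≤n x' × IsMaximal α k≤n x' × ¬ S (x' i) × SameOutputs x x'

module Submission where

-- Part (i) consists of three general implications, each obtained by
-- specialising the quantifiers of the stronger notion: infinite-step opacity
-- covers every position of every maximal run, hence in particular position 0
-- (initial-state opacity) and the last K positions of full-length runs
-- (K-step opacity, for any K); K-step opacity covers the last position
-- (current-state opacity).
--
-- Parts (ii)-(iv) need only two small counterexamples, since every failure of
-- a weaker notion is transported to the stronger ones by part (i):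
--   * twoBranches: a secret chain s₀→s₁→s₂ beside a public chain p₀→p₁→p₂,
--     where only s₂ is observably flagged.  It is 1-step (hence current-state)
--     opaque, but neither initial-state nor 2-step opaque (nor, by (i),
--     infinite-step opaque): after two steps the observer knows the start.
--   * revealingStep: the only transition leads from a public initial state
--     into a secret one.  It is initial-state opaque, but not current-state
--     opaque (nor, by (i), K-step or infinite-step opaque).

open import Defs
open import Data.Nat using (ℕ; zero; suc; _<_; _∸_; _≤_; z≤n; s≤s)
open import Data.Nat.Properties using (≤-refl; m∸n≤m)
open import Data.Fin using (Fin; zero; suc; fromℕ; toℕ)
open import Data.Fin.Properties using (toℕ-fromℕ)
open import Data.Product using (Σ; _×_; _,_)
open import Data.Sum using (inj₁)
open import Data.Unit using (⊤; tt)
open import Data.Bool using (Bool; true; false)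
open import Data.Empty using (⊥-elim)
open import Relation.Nullary using (¬_)
open import Relation.Binary.PropositionalEquality using (_≡_; refl; sym; trans; subst)

lastPosition-inWindow : ∀ K n → n ∸ K ≤ toℕ (fromℕ n)
lastPosition-inWindow K n = subst (n ∸ K ≤_) (sym (toℕ-fromℕ n)) (m∸n≤m n K)

module _ (T : NTS) where

  -- A full-length run is maximal, and its last K positions include i;
  -- so infinite-step opacity yields K-step opacity for every K.
  infinite⇒KStep : ∀ K → InfiniteStepOpaque T → KStepOpaque T K
  infinite⇒KStep K inf n α x run i _ secret
    with inf n α n ≤-refl x run (inj₁ refl) i secret
  ... | x' , run' , _ , notSecret , same = x' , run' , notSecret , same

  infinite⇒initial : InfiniteStepOpaque T → InitialStateOpaque T
  infinite⇒initial inf n α k k≤n x run maximal secret =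
    inf n α k k≤n x run maximal zero secret

  KStep⇒current : ∀ K → KStepOpaque T K → CurrentStateOpaque T
  KStep⇒current K kso n α x run =
    kso n α x run (fromℕ n) (lastPosition-inWindow K n)

  infinite⇒current : InfiniteStepOpaque T → CurrentStateOpaque T
  infinite⇒current inf = KStep⇒current 1 (infinite⇒KStep 1 inf)

data Branch : Set where
  s₀ s₁ s₂ p₀ p₁ p₂ : Branch

data BranchInitial : Branch → Set where
  s₀-initial : BranchInitial s₀
  p₀-initial : BranchInitial p₀

data BranchSecret : Branch → Set where
  s₀-secret : BranchSecret s₀

data BranchStep : Branch → Branch → Set where
  s₀→s₁ : BranchStep s₀ s₁
  s₁→s₂ : BranchStep s₁ s₂
  p₀→p₁ : BranchStep p₀ p₁
  p₁→p₂ : BranchStep p₁ p₂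

flag : Branch → Bool
flag s₂ = true
flag _  = false

twoBranches : NTS
twoBranches = record
  { X = Branch ; X₀ = BranchInitial ; S = BranchSecret
  ; U = ⊤ ; Trans = λ p _ q → BranchStep p q ; Y = Bool ; h = flag }

nothingEntersSecret : ∀ {p q} → BranchStep p q → ¬ BranchSecret q
nothingEntersSecret () s₀-secret

secretUnflagged : ∀ {p} → BranchSecret p → flag p ≡ false
secretUnflagged s₀-secret = refl

successorOfSecretUnflagged : ∀ {p q} → BranchSecret p → BranchStep p q → flag q ≡ false
successorOfSecretUnflagged s₀-secret s₀→s₁ = refl

-- A secret state at one of the last two positions of a run forces n ≤ 1,
-- and then the public branch provides an indistinguishable run.
twoBranches-1Step : KStepOpaque twoBranches 1
twoBranches-1Step n α x (_ , steps) (suc j) _ secret =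
  ⊥-elim (nothingEntersSecret (steps j) secret)
twoBranches-1Step zero α x _ zero _ secret =
  (λ _ → p₀) , (p₀-initial , λ ()) , (λ ()) , λ { zero → secretUnflagged secret }
twoBranches-1Step (suc zero) α x (_ , steps) zero _ secret =
  (λ { zero → p₀ ; (suc zero) → p₁ }) , (p₀-initial , λ { zero → p₀→p₁ }) , (λ ()) ,
  λ { zero → secretUnflagged secret
    ; (suc zero) → successorOfSecretUnflagged secret (steps zero) }
twoBranches-1Step (suc (suc n)) α x _ zero () secret

secretRun : Fin 3 → Branch
secretRun zero = s₀
secretRun (suc zero) = s₁
secretRun (suc (suc zero)) = s₂

secretRun-isRun : IsRun twoBranches {2} (λ _ → tt) ≤-refl secretRun
secretRun-isRun = s₀-initial , λ { zero → s₀→s₁ ; (suc zero) → s₁→s₂ }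

publicRunsEndUnflagged : ∀ {n} {α : Fin n → ⊤} (2≤n : 2 ≤ n) {x : Fin 3 → Branch} →
  IsRun twoBranches α 2≤n x → ¬ BranchSecret (x zero) → flag (x (suc (suc zero))) ≡ false
publicRunsEndUnflagged _ (start , steps) notSecret =
  endUnflagged start notSecret (steps zero) (steps (suc zero))
  where
  endUnflagged : ∀ {p q r} → BranchInitial p → ¬ BranchSecret p →
    BranchStep p q → BranchStep q r → flag r ≡ false
  endUnflagged s₀-initial notSecret₀ _ _ = ⊥-elim (notSecret₀ s₀-secret)
  endUnflagged p₀-initial _ p₀→p₁ p₁→p₂ = refl

noPublicTwin : {x : Fin 3 → Branch} → IsRun twoBranches (λ _ → tt) ≤-refl x →
  ¬ BranchSecret (x zero) → ¬ SameOutputs twoBranches secretRun x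
noPublicTwin {x} run notSecret same
  with trans (same (suc (suc zero))) (publicRunsEndUnflagged ≤-refl {x} run notSecret)
... | ()

twoBranches-notInitial : ¬ InitialStateOpaque twoBranches
twoBranches-notInitial iso
  with iso 2 (λ _ → tt) 2 ≤-refl secretRun secretRun-isRun (inj₁ refl) s₀-secret
... | _ , run , _ , notSecret , same = noPublicTwin run notSecret same

twoBranches-not2Step : ¬ KStepOpaque twoBranches 2
twoBranches-not2Step kso
  with kso 2 (λ _ → tt) secretRun secretRun-isRun zero z≤n s₀-secret
... | _ , run , notSecret , same = noPublicTwin run notSecret same

data Reveal : Set where
  start secret : Reveal

data RevealInitial : Reveal → Set where
  start-initial : RevealInitial start

data RevealSecret : Reveal → Set where
  secret-secret : RevealSecret secret

data RevealStep : Reveal → Reveal → Set where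
  start→secret : RevealStep start secret

revealingStep : NTS
revealingStep = record
  { X = Reveal ; X₀ = RevealInitial ; S = RevealSecret
  ; U = ⊤ ; Trans = λ p _ q → RevealStep p q ; Y = ⊤ ; h = λ _ → tt }

-- No initial state is secret, so initial-state opacity holds vacuously.
revealingStep-initial : InitialStateOpaque revealingStep
revealingStep-initial n α k k≤n x (initial , _) _ secretStart =
  ⊥-elim (initialIsPublic initial secretStart)
  where
  initialIsPublic : ∀ {p} → RevealInitial p → ¬ RevealSecret p
  initialIsPublic start-initial ()

revealingRun : Fin 2 → Reveal
revealingRun zero = start
revealingRun (suc zero) = secret

-- Every step ends in the secret state, so after one step it is certain.
revealingStep-notCurrent : ¬ CurrentStateOpaque revealingStep
revealingStep-notCurrent cso
  with cso 1 (λ _ → tt) revealingRun (start-initial , λ { zero → start→secret }) secret-secret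
... | _ , (_ , steps) , notSecret , _ = stepEndsSecret (steps zero) notSecret
  where
  stepEndsSecret : ∀ {p q} → RevealStep p q → ¬ ¬ RevealSecret q
  stepEndsSecret start→secret notSecret = notSecret secret-secret

theorem4p1 : ((T : NTS) (K : ℕ) → 0 < K →
    (InfiniteStepOpaque T → KStepOpaque T K × CurrentStateOpaque T × InitialStateOpaque T)
    × (KStepOpaque T K → CurrentStateOpaque T))
    × Σ NTS (λ T → CurrentStateOpaque T × ¬ InitialStateOpaque T)
    × Σ ℕ (λ K → 0 < K × Σ NTS (λ T → CurrentStateOpaque T × ¬ KStepOpaque T K))
    × Σ NTS (λ T → CurrentStateOpaque T × ¬ InfiniteStepOpaque T)
    × Σ ℕ (λ K → 0 < K × Σ NTS (λ T → KStepOpaque T K × ¬ InfiniteStepOpaque T))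
    × Σ ℕ (λ K → 0 < K × Σ NTS (λ T → KStepOpaque T K × ¬ InitialStateOpaque T))
    × Σ NTS (λ T → InitialStateOpaque T × ¬ CurrentStateOpaque T)
    × Σ ℕ (λ K → 0 < K × Σ NTS (λ T → InitialStateOpaque T × ¬ KStepOpaque T K))
    × Σ NTS (λ T → InitialStateOpaque T × ¬ InfiniteStepOpaque T)
theorem4p1 =
    (λ T K _ → (λ inf → infinite⇒KStep T K inf , infinite⇒current T inf , infinite⇒initial T inf)
             , KStep⇒current T K)
  , (twoBranches , twoBranches-current , twoBranches-notInitial)
  , (2 , s≤s z≤n , twoBranches , twoBranches-current , twoBranches-not2Step)
  , (twoBranches , twoBranches-current , twoBranches-notInfinite)
  , (1 , s≤s z≤n , twoBranches , twoBranches-1Step , twoBranches-notInfinite)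
  , (1 , s≤s z≤n , twoBranches , twoBranches-1Step , twoBranches-notInitial)
  , (revealingStep , revealingStep-initial , revealingStep-notCurrent)
  , (1 , s≤s z≤n , revealingStep , revealingStep-initial ,
       λ kso → revealingStep-notCurrent (KStep⇒current revealingStep 1 kso))
  , (revealingStep , revealingStep-initial ,
       λ inf → revealingStep-notCurrent (infinite⇒current revealingStep inf))
  where
  twoBranches-current : CurrentStateOpaque twoBranches
  twoBranches-current = KStep⇒current twoBranches 1 twoBranches-1Step
  twoBranches-notInfinite : ¬ InfiniteStepOpaque twoBranches
  twoBranches-notInfinite inf = twoBranches-notInitial (infinite⇒initial twoBranches inf)
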